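{- In the pure bang calculus $(\Lambda_!,\to_{!\beta})$, the least-level reduction $\to_{\ell\ell,!\beta}$ is quasi-diamond: whenever $T_1 \leftarrow_{\ell\ell,!\beta} T \to_{\ell\ell,!\beta} T_2$, either $T_1=T_2$ or there is $U$ with $T_1\to_{\ell\ell,!\beta}U\leftarrow_{\ell\ell,!\beta}T_2$. Consequently $\to_{\ell\ell,!\beta}$ is uniformly normalizing (every weakly $\to_{\ell\ell,!\beta}$-normalizing term is strongly $\to_{\ell\ell,!\beta}$-normalizing).
   Context: Pure bang terms: $T ::= x\mid\lambda x.T\mid TS\mid !T$ (set $\Lambda_!$), contexts $C ::= [\cdot]\mid\lambda x.C\mid TC\mid CT\mid !C$. $\to_{!\beta}$ is the contextual closure of $(\lambda x.T)\,!S\mapsto_{!\beta}T[S/x]$. Level: $\mathrm{lev}([\cdot])=0$, $\mathrm{lev}(!C)=\mathrm{lev}(C)+1$, unchanged under $\lambda$ and application. $\mathrm{ll}(T)=\inf\{\mathrm{lev}(C)\mid T=C[R], R\text{ a }!\beta\text{ -redex}\}$. A step $C[R]\to_{!\beta}C[R']$ is least-level ($\to_{\ell\ell,!\beta}$) if $\mathrm{lev}(C)=\mathrm{ll}(C[R])$. -}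

module Defs where

open import Data.Nat using (ℕ; zero; suc; _≤_; pred; compare; less; equal; greater)
open import Data.Product using (Σ; ∃; _×_; _,_)
open import Relation.Binary.PropositionalEquality using (_≡_)
open import Relation.Nullary using (¬_)
open import Relation.Binary.Construct.Closure.ReflexiveTransitive using (Star)
open import Induction.WellFounded using (Acc)

-- Pure bang terms, with de Bruijn indices (so syntactic equality = α-equivalence).
data Term : Set where
  var  : ℕ → Term
  lam  : Term → Term
  app  : Term → Term → Term
  bang : Term → Term

shift : ℕ → Term → Term
shift c (var k) with compare k c
... | less _ _    = var k
... | equal _     = var (suc k)
... | greater _ _ = var (suc k)
shift c (lam T)   = lam (shift (suc c) T)
shift c (app T S) = app (shift c T) (shift c S)
shift c (bang T)  = bang (shift c T)

-- subst j S T : capture-avoiding substitution T[S/j] removing binder j.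
subst : ℕ → Term → Term → Term
subst j S (var k) with compare k j
... | less _ _          = var k
... | equal _           = S
... | greater _ _       = var (pred k)
subst j S (lam T)   = lam (subst (suc j) (shift 0 S) T)
subst j S (app T U) = app (subst j S T) (subst j S U)
subst j S (bang T)  = bang (subst j S T)

data Ctx : Set where
  hole  : Ctx
  lamC  : Ctx → Ctx
  appR  : Term → Ctx → Ctx
  appL  : Ctx → Term → Ctx
  bangC : Ctx → Ctx

plug : Ctx → Term → Term
plug hole       R = R
plug (lamC C)   R = lam (plug C R)
plug (appR T C) R = app T (plug C R)
plug (appL C T) R = app (plug C R) T
plug (bangC C)  R = bang (plug C R)

lev : Ctx → ℕ
lev hole       = 0
lev (lamC C)   = lev C
lev (appR _ C) = lev C
lev (appL C _) = lev C
lev (bangC C)  = suc (lev C)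

data _↦!β_ : Term → Term → Set where
  root : ∀ T S → app (lam T) (bang S) ↦!β subst 0 S T

IsRedex : Term → Set
IsRedex R = ∃ λ R' → R ↦!β R'

-- Least-level step: C[R] → C[R'] where lev C = ll(C[R]), i.e. lev C is ≤ the
-- level of every redex occurrence of C[R] (the infimum is attained at C).
record _→ll_ (T U : Term) : Set where
  constructor llstep
  field
    C     : Ctx
    R R'  : Term
    redT  : T ≡ plug C R
    redU  : U ≡ plug C R'
    contr : R ↦!β R'
    least : ∀ (C' : Ctx) (R'' : Term) → T ≡ plug C' R'' → IsRedex R'' → lev C ≤ lev C'

Normal : Term → Set
Normal T = ∀ U → ¬ (T →ll U)

_→ll*_ : Term → Term → Set
_→ll*_ = Star _→ll_

WN : Term → Set
WN T = ∃ λ U → (T →ll* U) × Normal U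

_←ll_ : Term → Term → Set
U ←ll T = T →ll U

SN : Term → Set
SN T = Acc _←ll_ T

-- Two least-level steps from the same term fire redexes at one and the same level k,
-- so it suffices to study steps at a fixed level. These are quasi-diamond: a level-k
-- redex never lies inside the banged argument of another level-k redex, and contracting
-- a redex does not duplicate its body. Moreover a step at level k creates no redex below
-- level k (for k > 0 it happens under a ! and preserves the head constructor of every
-- enclosing subterm), so the joining steps are again least-level. Finally, in a
-- quasi-diamond relation all reductions to a normal form have the same length, which
-- bounds every reduction sequence from a weakly normalizing term.
module Submission where

open import Defs
open import Data.Nat using (ℕ; zero; suc; _≤_; _<_; z≤n; s≤s; pred; compare; less; equal; greater)
open import Data.Nat.Properties
  using (≤-trans; <-≤-trans; <-asym; <⇒≱; n≮n; n≤1+n; m≤m+n; m≤n⇒m≤1+n; m≢1+m+n; ≤-pred; ≤-antisym; <-cmp; <-≤-connex)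
open import Data.Product using (∃; _×_; _,_; proj₁)
open import Data.Sum using (_⊎_; inj₁; inj₂)
import Data.Sum as Sum
open import Data.Unit using (⊤; tt)
open import Function using (flip)
open import Relation.Nullary using (¬_; contradiction)
open import Relation.Binary.Definitions using (tri<; tri≈; tri>)
open import Relation.Binary.PropositionalEquality using (_≡_; refl; sym; trans; cong; cong₂)
  renaming (subst to transport)
open import Relation.Binary.Construct.Closure.ReflexiveTransitive using (Star; ε; _◅_)
open import Induction.WellFounded using (Acc; acc)

QuasiDiamond : {A : Set} → (A → A → Set) → Set
QuasiDiamond {A} _⟶_ = ∀ (T T₁ T₂ : A) → T ⟶ T₁ → T ⟶ T₂ → T₁ ≡ T₂ ⊎ ∃ λ U → (T₁ ⟶ U) × (T₂ ⟶ U)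

module _ {A : Set} {_⟶_ : A → A → Set} (quasiDiamond : QuasiDiamond _⟶_) where

  data ReducesIn : ℕ → A → A → Set where
    ε   : ∀ {T} → ReducesIn zero T T
    _◅_ : ∀ {n T T' N} → T ⟶ T' → ReducesIn n T' N → ReducesIn (suc n) T N

  star⇒reducesIn : ∀ {T N} → Star _⟶_ T N → ∃ λ n → ReducesIn n T N
  star⇒reducesIn ε       = _ , ε
  star⇒reducesIn (s ◅ p) with star⇒reducesIn p
  ... | n , q = suc n , s ◅ q

  reducesIn-step : ∀ {n T T' N} → (∀ U → ¬ (N ⟶ U)) →
                   ReducesIn (suc n) T N → T ⟶ T' → ReducesIn n T' N
  reducesIn-step {T = T} {T'} nf (_◅_ {T' = T₁} s p) s' with quasiDiamond T T₁ T' s s'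
  ... | inj₁ refl = p
  reducesIn-step nf (_ ◅ ε)         _ | inj₂ (U , t₁ , _)  = contradiction t₁ (nf U)
  reducesIn-step nf (_ ◅ p@(_ ◅ _)) _ | inj₂ (U , t₁ , t') = t' ◅ reducesIn-step nf p t₁

  reducesIn⇒acc : ∀ n {T N} → (∀ U → ¬ (N ⟶ U)) → ReducesIn n T N → Acc (flip _⟶_) T
  reducesIn⇒acc zero    nf ε = acc λ {U} s → contradiction s (nf U)
  reducesIn⇒acc (suc n) nf p = acc λ s → reducesIn⇒acc n nf (reducesIn-step nf p s)

  quasiDiamond-wn⇒sn : ∀ {T N} → Star _⟶_ T N → (∀ U → ¬ (N ⟶ U)) → Acc (flip _⟶_) T
  quasiDiamond-wn⇒sn p nf with star⇒reducesIn p
  ... | n , q = reducesIn⇒acc n nf q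

shift-var-< : ∀ {c k} → k < c → shift c (var k) ≡ var k
shift-var-< {c} {k} k<c with compare k c
... | less _ _    = refl
... | equal _     = contradiction k<c (n≮n k)
... | greater _ m = contradiction (s≤s (m≤m+n c m)) (<-asym k<c)

shift-var-≥ : ∀ {c k} → c ≤ k → shift c (var k) ≡ var (suc k)
shift-var-≥ {c} {k} c≤k with compare k c
... | less _ m    = contradiction c≤k (<⇒≱ (s≤s (m≤m+n k m)))
... | equal _     = refl
... | greater _ _ = refl

subst-var-< : ∀ S {j k} → k < j → subst j S (var k) ≡ var k
subst-var-< S {j} {k} k<j with compare k j
... | less _ _    = refl
... | equal _     = contradiction k<j (n≮n k)
... | greater _ m = contradiction (s≤s (m≤m+n j m)) (<-asym k<j)

subst-var-≡ : ∀ S {j k} → k ≡ j → subst j S (var k) ≡ S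
subst-var-≡ S {j} {k} k≡j with compare k j
... | less _ _    = contradiction k≡j (m≢1+m+n k)
... | equal _     = refl
... | greater _ _ = contradiction (sym k≡j) (m≢1+m+n j)

subst-var-> : ∀ S {j k} → j < k → subst j S (var k) ≡ var (pred k)
subst-var-> S {j} {k} j<k with compare k j
... | less _ m    = contradiction (s≤s (m≤m+n k m)) (<-asym j<k)
... | equal _     = contradiction j<k (n≮n j)
... | greater _ _ = refl

shift-shift : ∀ {c c'} T → c' ≤ c → shift (suc c) (shift c' T) ≡ shift c' (shift c T)
shift-shift {c} {c'} (var k) c'≤c with <-≤-connex k c'
... | inj₁ k<c'
  rewrite shift-var-< (<-≤-trans k<c' c'≤c) | shift-var-< k<c'
        | shift-var-< {suc c} (<-≤-trans k<c' (≤-trans c'≤c (n≤1+n c))) = refl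
... | inj₂ c'≤k with <-≤-connex k c
...   | inj₁ k<c
  rewrite shift-var-< k<c | shift-var-≥ c'≤k | shift-var-< {suc c} (s≤s k<c) = refl
...   | inj₂ c≤k
  rewrite shift-var-≥ c≤k | shift-var-≥ c'≤k | shift-var-≥ {suc c} (s≤s c≤k)
        | shift-var-≥ {c'} (m≤n⇒m≤1+n c'≤k) = refl
shift-shift (lam T)   c'≤c = cong lam (shift-shift T (s≤s c'≤c))
shift-shift (app T S) c'≤c = cong₂ app (shift-shift T c'≤c) (shift-shift S c'≤c)
shift-shift (bang T)  c'≤c = cong bang (shift-shift T c'≤c)

subst-shift : ∀ c S T → subst c S (shift c T) ≡ T
subst-shift c S (var k) with <-≤-connex k c
... | inj₁ k<c rewrite shift-var-< k<c = subst-var-< S k<c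
... | inj₂ c≤k rewrite shift-var-≥ c≤k = subst-var-> S (s≤s c≤k)
subst-shift c S (lam T)   = cong lam (subst-shift (suc c) (shift 0 S) T)
subst-shift c S (app T U) = cong₂ app (subst-shift c S T) (subst-shift c S U)
subst-shift c S (bang T)  = cong bang (subst-shift c S T)

shift-subst : ∀ {c j} S T → c ≤ j → shift c (subst j S T) ≡ subst (suc j) (shift c S) (shift c T)
shift-subst {c} {j} S (var k) c≤j with <-cmp k j
... | tri< k<j _ _ with <-≤-connex k c
...   | inj₁ k<c
  rewrite subst-var-< S k<j | shift-var-< k<c
        | subst-var-< (shift c S) (<-≤-trans k<j (n≤1+n j)) = refl
...   | inj₂ c≤k
  rewrite subst-var-< S k<j | shift-var-≥ c≤k | subst-var-< (shift c S) (s≤s k<j) = refl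
shift-subst {c} {j} S (var k) c≤j | tri≈ _ refl _
  rewrite subst-var-≡ S {k} refl | shift-var-≥ c≤j | subst-var-≡ (shift c S) {suc k} refl = refl
shift-subst {c} {j} S (var (suc k)) c≤j | tri> _ _ j<k
  rewrite subst-var-> S j<k | shift-var-≥ (≤-trans c≤j (≤-pred j<k))
        | shift-var-≥ {c} {suc k} (≤-trans c≤j (≤-trans (n≤1+n j) j<k))
        | subst-var-> (shift c S) (s≤s j<k) = refl
shift-subst {c} S (lam T) c≤j =
  cong lam (trans (shift-subst (shift 0 S) T (s≤s c≤j))
                  (cong (λ X → subst _ X (shift (suc c) T)) (shift-shift S z≤n)))
shift-subst S (app T U) c≤j = cong₂ app (shift-subst S T c≤j) (shift-subst S U c≤j)
shift-subst S (bang T)  c≤j = cong bang (shift-subst S T c≤j)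

subst-subst : ∀ {i j} B Q P → i ≤ j →
              subst j B (subst i Q P) ≡ subst i (subst j B Q) (subst (suc j) (shift i B) P)
subst-subst {i} {j} B Q (var k) i≤j with <-cmp k i
... | tri< k<i _ _
  rewrite subst-var-< Q k<i | subst-var-< B (<-≤-trans k<i i≤j)
        | subst-var-< (shift i B) (<-≤-trans k<i (≤-trans i≤j (n≤1+n j)))
        | subst-var-< (subst j B Q) k<i = refl
... | tri≈ _ refl _
  rewrite subst-var-≡ Q {k} refl | subst-var-< (shift k B) (s≤s i≤j)
        | subst-var-≡ (subst j B Q) {k} refl = refl
subst-subst {i} {j} B Q (var (suc k)) i≤j | tri> _ _ i<k with <-cmp k j
... | tri< k<j _ _
  rewrite subst-var-> Q i<k | subst-var-< B k<j | subst-var-< (shift i B) (s≤s k<j)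
        | subst-var-> (subst j B Q) i<k = refl
... | tri≈ _ refl _
  rewrite subst-var-> Q i<k | subst-var-≡ B {k} refl | subst-var-≡ (shift i B) {suc k} refl
  = sym (subst-shift i (subst k B Q) B)
subst-subst {i} {j} B Q (var (suc (suc k))) i≤j | tri> _ _ i<k | tri> _ _ j<k
  rewrite subst-var-> Q i<k | subst-var-> B j<k | subst-var-> (shift i B) (s≤s j<k)
        | subst-var-> (subst j B Q) (≤-trans (s≤s i≤j) j<k) = refl
subst-subst {i} B Q (lam P) i≤j =
  cong lam (trans (subst-subst (shift 0 B) (shift 0 Q) P (s≤s i≤j))
                  (cong₂ (λ X Y → subst (suc i) X (subst _ Y P)) (sym (shift-subst B Q z≤n)) (shift-shift B z≤n)))
subst-subst B Q (app P U) i≤j = cong₂ app (subst-subst B Q P i≤j) (subst-subst B Q U i≤j)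
subst-subst B Q (bang P)  i≤j = cong bang (subst-subst B Q P i≤j)

infix 4 _→!β[_]_

data _→!β[_]_ : Term → ℕ → Term → Set where
  β      : ∀ {R R'} → R ↦!β R' → R →!β[ 0 ] R'
  ξ-lam  : ∀ {k T U} → T →!β[ k ] U → lam T →!β[ k ] lam U
  ξ-appˡ : ∀ {k T U} S → T →!β[ k ] U → app T S →!β[ k ] app U S
  ξ-appʳ : ∀ {k S U} T → S →!β[ k ] U → app T S →!β[ k ] app T U
  ξ-bang : ∀ {k T U} → T →!β[ k ] U → bang T →!β[ suc k ] bang U

step-subst : ∀ {k T U} j S → T →!β[ k ] U → subst j S T →!β[ k ] subst j S U
step-subst j S (β (root T Q)) rewrite subst-subst S Q T (z≤n {j}) = β (root _ _)
step-subst j S (ξ-lam s)      = ξ-lam (step-subst (suc j) (shift 0 S) s)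
step-subst j S (ξ-appˡ _ s)   = ξ-appˡ _ (step-subst j S s)
step-subst j S (ξ-appʳ _ s)   = ξ-appʳ _ (step-subst j S s)
step-subst j S (ξ-bang s)     = ξ-bang (step-subst j S s)

step-quasiDiamond : ∀ k → QuasiDiamond (_→!β[ k ]_)
step-quasiDiamond _ _ _ _ (β (root T S)) (β (root .T .S))     = inj₁ refl
step-quasiDiamond _ _ _ _ (β (root _ S)) (ξ-appˡ _ (ξ-lam s)) = inj₂ (_ , step-subst 0 S s , β (root _ _))
step-quasiDiamond _ _ _ _ (ξ-appˡ _ (ξ-lam s)) (β (root _ S)) = inj₂ (_ , β (root _ _) , step-subst 0 S s)
step-quasiDiamond _ _ _ _ (β (root _ _)) (ξ-appˡ _ (β ()))
step-quasiDiamond _ _ _ _ (ξ-appˡ _ (β ())) (β (root _ _))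
step-quasiDiamond _ _ _ _ (β (root _ _)) (ξ-appʳ _ (β ()))
step-quasiDiamond _ _ _ _ (ξ-appʳ _ (β ())) (β (root _ _))
step-quasiDiamond k _ _ _ (ξ-lam s) (ξ-lam s') =
  Sum.map (cong lam) (λ (U , t , t') → lam U , ξ-lam t , ξ-lam t') (step-quasiDiamond k _ _ _ s s')
step-quasiDiamond (suc k) _ _ _ (ξ-bang s) (ξ-bang s') =
  Sum.map (cong bang) (λ (U , t , t') → bang U , ξ-bang t , ξ-bang t') (step-quasiDiamond k _ _ _ s s')
step-quasiDiamond k _ _ _ (ξ-appˡ S s) (ξ-appˡ .S s') =
  Sum.map (cong (λ X → app X S)) (λ (U , t , t') → app U S , ξ-appˡ S t , ξ-appˡ S t') (step-quasiDiamond k _ _ _ s s')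
step-quasiDiamond k _ _ _ (ξ-appʳ T s) (ξ-appʳ .T s') =
  Sum.map (cong (app T)) (λ (U , t , t') → app T U , ξ-appʳ T t , ξ-appʳ T t') (step-quasiDiamond k _ _ _ s s')
step-quasiDiamond _ _ _ _ (ξ-appˡ _ s) (ξ-appʳ _ s') = inj₂ (_ , ξ-appʳ _ s' , ξ-appˡ _ s)
step-quasiDiamond _ _ _ _ (ξ-appʳ _ s) (ξ-appˡ _ s') = inj₂ (_ , ξ-appˡ _ s' , ξ-appʳ _ s)

RedexesAtLevel≥ : ℕ → Term → Set
RedexesAtLevel≥ k T = ∀ C R → T ≡ plug C R → IsRedex R → k ≤ lev C

-- Structural form of RedexesAtLevel≥, along which preservation under steps is proved.
NoRedexBelow : ℕ → Term → Set
NoRedexBelow zero    _         = ⊤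
NoRedexBelow (suc k) (var _)   = ⊤
NoRedexBelow (suc k) (lam T)   = NoRedexBelow (suc k) T
NoRedexBelow (suc k) (app T S) = ¬ IsRedex (app T S) × NoRedexBelow (suc k) T × NoRedexBelow (suc k) S
NoRedexBelow (suc k) (bang T)  = NoRedexBelow k T

noRedexBelow-plug : ∀ k C {R} → NoRedexBelow k (plug C R) → IsRedex R → k ≤ lev C
noRedexBelow-plug zero    _          _            _                  = z≤n
noRedexBelow-plug (suc k) hole       nb           r@(_ , root _ _) = contradiction r (proj₁ nb)
noRedexBelow-plug (suc k) (lamC C)   nb           r = noRedexBelow-plug (suc k) C nb r
noRedexBelow-plug (suc k) (appR T C) (_ , _ , nb) r = noRedexBelow-plug (suc k) C nb r
noRedexBelow-plug (suc k) (appL C S) (_ , nb , _) r = noRedexBelow-plug (suc k) C nb r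
noRedexBelow-plug (suc k) (bangC C)  nb           r = s≤s (noRedexBelow-plug k C nb r)

noRedexBelow⇒redexesAtLevel≥ : ∀ k T → NoRedexBelow k T → RedexesAtLevel≥ k T
noRedexBelow⇒redexesAtLevel≥ k _ nb C _ refl = noRedexBelow-plug k C nb

redexesAtLevel≥⇒noRedexBelow : ∀ k T → RedexesAtLevel≥ k T → NoRedexBelow k T
redexesAtLevel≥⇒noRedexBelow zero    _         _  = tt
redexesAtLevel≥⇒noRedexBelow (suc k) (var _)   _  = tt
redexesAtLevel≥⇒noRedexBelow (suc k) (lam T)   ra =
  redexesAtLevel≥⇒noRedexBelow (suc k) T λ C R eq → ra (lamC C) R (cong lam eq)
redexesAtLevel≥⇒noRedexBelow (suc k) (app T S) ra =
  (λ r → contradiction (ra hole _ refl r) λ ()) ,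
  redexesAtLevel≥⇒noRedexBelow (suc k) T (λ C R eq → ra (appL C S) R (cong (λ X → app X S) eq)) ,
  redexesAtLevel≥⇒noRedexBelow (suc k) S (λ C R eq → ra (appR T C) R (cong (app T) eq))
redexesAtLevel≥⇒noRedexBelow (suc k) (bang T)  ra =
  redexesAtLevel≥⇒noRedexBelow k T λ C R eq r → ≤-pred (ra (bangC C) R (cong bang eq) r)

redex-appˡ-reflect : ∀ {k T U} V → T →!β[ suc k ] U → IsRedex (app U V) → IsRedex (app T V)
redex-appˡ-reflect _ (ξ-lam {T = T} _) (_ , root _ S) = _ , root T S

redex-appʳ-reflect : ∀ {k S U} T → S →!β[ suc k ] U → IsRedex (app T U) → IsRedex (app T S)
redex-appʳ-reflect _ (ξ-bang {T = S} _) (_ , root T _) = _ , root T S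

noRedexBelow-step : ∀ {k T U} → T →!β[ k ] U → NoRedexBelow k T → NoRedexBelow k U
noRedexBelow-step {zero}  _              _ = tt
noRedexBelow-step {suc k} (ξ-lam s)      nb = noRedexBelow-step s nb
noRedexBelow-step {suc k} (ξ-appˡ S s) (¬r , nbT , nbS) =
  (λ r → ¬r (redex-appˡ-reflect S s r)) , noRedexBelow-step s nbT , nbS
noRedexBelow-step {suc k} (ξ-appʳ T s) (¬r , nbT , nbS) =
  (λ r → ¬r (redex-appʳ-reflect T s r)) , nbT , noRedexBelow-step s nbS
noRedexBelow-step {suc k} (ξ-bang s)     nb = noRedexBelow-step s nb

plug-step : ∀ C {R R'} → R ↦!β R' → plug C R →!β[ lev C ] plug C R'
plug-step hole       r = β r
plug-step (lamC C)   r = ξ-lam (plug-step C r)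
plug-step (appR T C) r = ξ-appʳ T (plug-step C r)
plug-step (appL C S) r = ξ-appˡ S (plug-step C r)
plug-step (bangC C)  r = ξ-bang (plug-step C r)

record PlugStep (k : ℕ) (T U : Term) : Set where
  constructor plugStep
  field
    C     : Ctx
    R R'  : Term
    redT  : T ≡ plug C R
    redU  : U ≡ plug C R'
    contr : R ↦!β R'
    level : lev C ≡ k

step⇒plugStep : ∀ {k T U} → T →!β[ k ] U → PlugStep k T U
step⇒plugStep (β r) = plugStep hole _ _ refl refl r refl
step⇒plugStep (ξ-lam s) with step⇒plugStep s
... | plugStep C R R' refl refl r l = plugStep (lamC C) R R' refl refl r l
step⇒plugStep (ξ-appˡ S s) with step⇒plugStep s
... | plugStep C R R' refl refl r l = plugStep (appL C S) R R' refl refl r l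
step⇒plugStep (ξ-appʳ T s) with step⇒plugStep s
... | plugStep C R R' refl refl r l = plugStep (appR T C) R R' refl refl r l
step⇒plugStep (ξ-bang s) with step⇒plugStep s
... | plugStep C R R' refl refl r l = plugStep (bangC C) R R' refl refl r (cong suc l)

step⇒→ll : ∀ {k T U} → T →!β[ k ] U → NoRedexBelow k T → T →ll U
step⇒→ll {T = T} s nb with step⇒plugStep s
... | plugStep C R R' redT redU r refl =
  llstep C R R' redT redU r (noRedexBelow⇒redexesAtLevel≥ (lev C) T nb)

→ll⇒step : ∀ {T U} (s : T →ll U) → let k = lev (_→ll_.C s) in T →!β[ k ] U × NoRedexBelow k T
→ll⇒step {T} (llstep C R R' refl refl r least) =
  plug-step C r , redexesAtLevel≥⇒noRedexBelow (lev C) T least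

→ll-levels-agree : ∀ {T T₁ T₂} (s₁ : T →ll T₁) (s₂ : T →ll T₂) →
                   lev (_→ll_.C s₁) ≡ lev (_→ll_.C s₂)
→ll-levels-agree (llstep C₁ R₁ _ redT₁ _ r₁ least₁) (llstep C₂ R₂ _ redT₂ _ r₂ least₂) =
  ≤-antisym (least₁ C₂ R₂ redT₂ (_ , r₂)) (least₂ C₁ R₁ redT₁ (_ , r₁))

→ll-sameLevel : ∀ {T T₁ T₂} → T →ll T₁ → T →ll T₂ →
                ∃ λ k → T →!β[ k ] T₁ × T →!β[ k ] T₂ × NoRedexBelow k T
→ll-sameLevel {T} {T₂ = T₂} s₁ s₂ with →ll⇒step s₁ | →ll⇒step s₂
... | t₁ , nb | t₂ , _ = _ , t₁ , transport (λ k → T →!β[ k ] T₂) (sym (→ll-levels-agree s₁ s₂)) t₂ , nb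

→ll-quasiDiamond : QuasiDiamond _→ll_
→ll-quasiDiamond T T₁ T₂ s₁ s₂ with →ll-sameLevel s₁ s₂
... | k , t₁ , t₂ , nb =
  Sum.map₂ (λ (U , u₁ , u₂) → U , step⇒→ll u₁ (noRedexBelow-step t₁ nb)
                                 , step⇒→ll u₂ (noRedexBelow-step t₂ nb))
           (step-quasiDiamond k T T₁ T₂ t₁ t₂)

lemma6 : (∀ T T₁ T₂ → T →ll T₁ → T →ll T₂ →
            T₁ ≡ T₂ ⊎ ∃ λ U → (T₁ →ll U) × (T₂ →ll U))
         × (∀ T → WN T → SN T)
lemma6 = →ll-quasiDiamond
       , λ where _ (_ , T↠N , nf) → quasiDiamond-wn⇒sn →ll-quasiDiamond T↠N nf
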